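{- For every forest \(G\) with \(n\) vertices and \(\operatorname{diam}^*(G) > 1/2\), and for every \(m\in\{1,\dots,n\}\), there is a partition \((B,W)\) of \(V(G)\) with \(|B|=m\) and \(e_G(B,W)\leq 2\).
   Context: \(e_G(B,W)\) is the number of edges with one end in \(B\) and the other in \(W\). For a forest \(G\) on \(n\) vertices with connected components \(G_1,\dots,G_k\), the relative diameter is \(\operatorname{diam}^*(G) := \frac1n\sum_{i=1}^k |V(P_i)|\), where \(P_i\) is a longest path in \(G_i\). -}

module Defs where

open import Data.Nat using (ℕ; zero; suc; _+_; _≤_; _<_)
open import Data.Fin using (Fin)
open import Data.Fin.Subset using (Subset; _∈_; _∉_)
open import Data.List using (List; []; _∷_; _++_; [_]; length; tabulate; allFin; concatMap; filter)
open import Data.Nat.ListAction using (sum)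
open import Data.List.Relation.Unary.Unique.Propositional using (Unique)
open import Data.Product using (Σ; _×_; _,_; ∃-syntax)
open import Relation.Nullary using (¬_; Dec)
open import Relation.Nullary.Decidable using (_×-dec_; ¬?)
open import Relation.Binary.PropositionalEquality using (_≡_; _≢_)
open import Data.Fin.Subset.Properties using (_∈?_)

record Graph (n : ℕ) : Set₁ where
  field
    Adj   : Fin n → Fin n → Set
    adj?  : (u v : Fin n) → Dec (Adj u v)
    sym   : ∀ {u v} → Adj u v → Adj v u
    irrefl : ∀ {u} → ¬ Adj u u

module _ {n : ℕ} (G : Graph n) where
  open Graph G

  data Chain : List (Fin n) → Set where
    []  : Chain []
    [-] : ∀ {x} → Chain (x ∷ [])
    _∷_ : ∀ {x y xs} → Adj x y → Chain (y ∷ xs) → Chain (x ∷ y ∷ xs)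

  IsPath : Fin n → List (Fin n) → Set
  IsPath x xs = Unique (x ∷ xs) × Chain (x ∷ xs)

  pathSize : Fin n → List (Fin n) → ℕ
  pathSize x xs = suc (length xs)

  IsCycle : Fin n → List (Fin n) → Set
  IsCycle x xs = 2 ≤ length xs × Unique (x ∷ xs) × Chain (x ∷ xs ++ [ x ])

  Forest : Set
  Forest = ∀ x xs → ¬ IsCycle x xs

  data Conn : Fin n → Fin n → Set where
    here : ∀ {u} → Conn u u
    step : ∀ {u v w} → Adj u v → Conn v w → Conn u w

  -- 2 · n · diam*(G) > n, i.e. diam*(G) > 1/2, unfolded: choose one longest
  -- path P_i in each connected component G_i (k components, indexed by Fin k).
  -- (Since longest-path lengths are determined, this existential is the same
  -- as the definition of diam*.)
  RelDiamGtHalf : Set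
  RelDiamGtHalf =
    Σ ℕ λ k →
    Σ (Fin k → Fin n) λ s →
    Σ (Fin k → List (Fin n)) λ ps →
      (∀ i → IsPath (s i) (ps i))
      × (∀ i j → i ≢ j → ¬ Conn (s i) (s j))
      × (∀ v → ∃[ i ] Conn v (s i))
      × (∀ i x xs → IsPath x xs → Conn x (s i) → pathSize x xs ≤ pathSize (s i) (ps i))
      × n < 2 Data.Nat.* sum (tabulate {n = k} λ i → pathSize (s i) (ps i))

  -- ordered pairs (u , v) with u ∈ B, v ∉ B, u ~ v: each B–W edge counted once
  eBW : Subset n → ℕ
  eBW B = length (filter (λ { (u , v) → (u ∈? B) ×-dec (¬? (v ∈? B)) ×-dec adj? u v })
                   (concatMap (λ u → Data.List.map (u ,_) (allFin n)) (allFin n)))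

-- Concatenate the chosen longest paths P₁, …, P_k into one list Π of
-- N = Σᵢ |V(Pᵢ)| vertices; the hypothesis diam*(G) > 1/2 says n < 2N.  Send
-- each vertex v to the first vertex of Π met on a walk from v to its
-- component's path, and call the position of that vertex in Π the layer of v.
-- Every edge of a forest is a bridge, so only path edges join different
-- layers, and they join consecutive layers t, t + 1, one edge for each t
-- (module Forests).  For any such layering let P t count the vertices below
-- layer t: P increases strictly from 0 to n on [0, N].  As n < 2N, the 2N
-- values P x and (P j + m) mod n in [0, n) collide (module Arithmetic), giving
-- a ≤ b with P b - P a = m or n - (P b - P a) = m.  The layers a, …, b - 1,
-- or their complement, then form B, and only the two path edges entering
-- layers a and b can leave B (module LayeredCut, built on the counting
-- modules AtMostTwo, Counting and Intervals).

module Submission where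

open import Defs
open import Data.Nat using (ℕ; suc; _+_; _≤_; _<_)
open import Data.Fin using (Fin)
open import Data.Fin.Subset using (Subset; ∣_∣)
open import Data.List using (length)
open import Data.Product using (Σ; _×_; _,_)
open import Data.Sum using (_⊎_)
open import Relation.Binary.PropositionalEquality using (_≡_; _≢_; subst)

module Arithmetic where
  open import Data.Nat using (ℕ; suc; _+_; _∸_; _≤_; _<_; s≤s; _<?_; _≤?_)
  open import Data.Nat.Properties
  open import Data.Fin using (toℕ; fromℕ<)
  import Data.Fin.Properties as FinP
  open import Data.Product using (Σ; _×_; _,_)
  open import Data.Sum using (_⊎_; inj₁; inj₂)
  open import Data.Empty using (⊥-elim)
  open import Relation.Nullary using (¬_; yes; no)
  open import Relation.Binary.PropositionalEquality using (_≡_; refl; sym; trans; cong; subst)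

  pigeonhole : (h : ℕ → ℕ) {M n : ℕ} → n < M → (∀ x → x < M → h x < n) →
               Σ ℕ λ x → Σ ℕ λ y → x < y × y < M × h x ≡ h y
  pigeonhole h {n = n} n<M h<n
    with i , j , i<j , eq ← FinP.pigeonhole n<M (λ i → fromℕ< (h<n (toℕ i) (FinP.toℕ<n i)))
    = toℕ i , toℕ j , i<j , FinP.toℕ<n j ,
      trans (sym (FinP.toℕ-fromℕ< _)) (trans (cong toℕ eq) (FinP.toℕ-fromℕ< _))

  InjectiveBelow : ℕ → (ℕ → ℕ) → Set
  InjectiveBelow N f = ∀ {x y} → x < N → y < N → f x ≡ f y → x ≡ y

  glue : ℕ → (ℕ → ℕ) → (ℕ → ℕ) → ℕ → ℕ
  glue N f g x with x <? N
  ... | yes _ = f x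
  ... | no  _ = g (x ∸ N)

  shifted<N : ∀ {N y} → y < N + N → ¬ y < N → y ∸ N < N
  shifted<N {N} {y} y<2N y≮N = subst (y ∸ N <_) (m+n∸m≡n N N) (∸-monoˡ-< y<2N (≮⇒≥ y≮N))

  glue<n : ∀ {N n} (f g : ℕ → ℕ) → (∀ x → x < N → f x < n) → (∀ x → x < N → g x < n) →
           ∀ x → x < N + N → glue N f g x < n
  glue<n {N} f g f<n g<n x x<2N with x <? N
  ... | yes x<N = f<n x x<N
  ... | no  x≮N = g<n (x ∸ N) (shifted<N x<2N x≮N)

  images-meet : ∀ {N n} (f g : ℕ → ℕ) → n < N + N →
                (∀ x → x < N → f x < n) → (∀ x → x < N → g x < n) →
                InjectiveBelow N f → InjectiveBelow N g →
                Σ ℕ λ x → Σ ℕ λ y → x < N × y < N × f x ≡ g y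
  images-meet {N} f g n<2N f<n g<n f-inj g-inj
    with x , y , x<y , y<2N , eq ← pigeonhole (glue N f g) n<2N (glue<n f g f<n g<n)
    = collision x y x<y y<2N eq
    where
    -- by injectivity, equal values of glue come from one f-value and one g-value
    collision : ∀ x y → x < y → y < N + N → glue N f g x ≡ glue N f g y →
                Σ ℕ λ x → Σ ℕ λ y → x < N × y < N × f x ≡ g y
    collision x y x<y y<2N eq with x <? N | y <? N
    ... | yes x<N | yes y<N = ⊥-elim (<⇒≢ x<y (f-inj x<N y<N eq))
    ... | no  x≮N | yes y<N = ⊥-elim (x≮N (<-trans x<y y<N))
    ... | yes x<N | no  y≮N = x , y ∸ N , x<N , shifted<N y<2N y≮N , eq
    ... | no  x≮N | no  y≮N =
          ⊥-elim (<⇒≢ x<y (∸-cancelʳ-≡ (≮⇒≥ x≮N) (≮⇒≥ y≮N)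
            (g-inj (shifted<N (<-trans x<y y<2N) x≮N) (shifted<N y<2N y≮N) eq)))

  -- Reduction of y ∈ [0, 2n) to the circle [0, n).
  wrap : ℕ → ℕ → ℕ
  wrap n y with y <? n
  ... | yes _ = y
  ... | no  _ = y ∸ n

  wrap-cases : ∀ n y → wrap n y ≡ y ⊎ wrap n y + n ≡ y
  wrap-cases n y with y <? n
  ... | yes _   = inj₁ refl
  ... | no  y≮n = inj₂ (m∸n+n≡m (≮⇒≥ y≮n))

  wrap<n : ∀ {n a m} → a < n → m ≤ n → wrap n (a + m) < n
  wrap<n {n} {a} {m} a<n m≤n with a + m <? n
  ... | yes a+m<n = a+m<n
  ... | no  a+m≮n = +-cancelʳ-< _ _ _
          (subst (_< n + n) (sym (m∸n+n≡m (≮⇒≥ a+m≮n))) (+-mono-<-≤ a<n m≤n))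

  wrapped<m : ∀ {n a m} → a < n → n ≤ a + m → a + m ∸ n < m
  wrapped<m {n} {a} {m} a<n n≤a+m = +-cancelʳ-< _ _ _
    (subst (_< m + n) (sym (m∸n+n≡m n≤a+m)) (subst (a + m <_) (+-comm n m) (+-monoˡ-< m a<n)))

  wrap-injective : ∀ {n a b} m → a < n → b < n → wrap n (a + m) ≡ wrap n (b + m) → a ≡ b
  wrap-injective {n} {a} {b} m a<n b<n eq with a + m <? n | b + m <? n
  ... | yes _   | yes _   = +-cancelʳ-≡ _ _ _ eq
  ... | yes _   | no  b≱n = ⊥-elim (<⇒≱ (wrapped<m b<n (≮⇒≥ b≱n)) (subst (m ≤_) eq (m≤n+m m a)))
  ... | no  a≱n | yes _   = ⊥-elim (<⇒≱ (wrapped<m a<n (≮⇒≥ a≱n)) (subst (m ≤_) (sym eq) (m≤n+m m b)))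
  ... | no  a≱n | no  b≱n = +-cancelʳ-≡ _ _ _ (∸-cancelʳ-≡ (≮⇒≥ a≱n) (≮⇒≥ b≱n) eq)

  step-increasing⇒monotone : (P : ℕ → ℕ) {N : ℕ} → (∀ t → t < N → P t < P (suc t)) →
                            ∀ {a b} → a < b → b ≤ N → P a < P b
  step-increasing⇒monotone P inc {a} {suc b} (s≤s a≤b) b<N with m≤n⇒m<n∨m≡n a≤b
  ... | inj₂ refl = inc b b<N
  ... | inj₁ a<b  = <-trans (step-increasing⇒monotone P inc a<b (<⇒≤ b<N)) (inc b b<N)

  module _ (P : ℕ → ℕ) {N n : ℕ}
           (P-mono : ∀ {a b} → a < b → b ≤ N → P a < P b) (P-top : P N ≡ n) where

    P-reflects-≤ : ∀ {a b} → a ≤ N → P a ≤ P b → a ≤ b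
    P-reflects-≤ {a} {b} a≤N Pa≤Pb with a ≤? b
    ... | yes a≤b = a≤b
    ... | no  a≰b = ⊥-elim (<⇒≱ (P-mono (≰⇒> a≰b) a≤N) Pa≤Pb)

    P-injective : InjectiveBelow N P
    P-injective x<N y<N eq =
      ≤-antisym (P-reflects-≤ (<⇒≤ x<N) (≤-reflexive eq)) (P-reflects-≤ (<⇒≤ y<N) (≤-reflexive (sym eq)))

    P<n : ∀ t → t < N → P t < n
    P<n t t<N = subst (P t <_) P-top (P-mono t<N ≤-refl)

    -- The values
    -- P x and (P j + m) mod n, x, j < N, are 2N > n points of [0, n), and
    -- each family is injective, so some P x meets some (P j + m) mod n.
    gap-or-cogap : n < N + N → ∀ m → m ≤ n →
                   Σ ℕ λ a → Σ ℕ λ b → a ≤ b × (P a + m ≡ P b ⊎ P b + m ≡ P a + n)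
    gap-or-cogap n<2N m m≤n
      with x , j , x<N , j<N , eq ← images-meet P (λ j → wrap n (P j + m)) n<2N P<n
             (λ j j<N → wrap<n (P<n j j<N) m≤n) P-injective
             (λ x<N y<N eq → P-injective x<N y<N (wrap-injective m (P<n _ x<N) (P<n _ y<N) eq))
      with wrap-cases n (P j + m)
    ... | inj₁ unwrapped = j , x , P-reflects-≤ (<⇒≤ j<N) Pj≤Px , inj₁ Pj+m≡Px
      where
      Pj+m≡Px : P j + m ≡ P x
      Pj+m≡Px = trans (sym unwrapped) (sym eq)
      Pj≤Px : P j ≤ P x
      Pj≤Px = ≤-trans (m≤m+n (P j) m) (≤-reflexive Pj+m≡Px)
    ... | inj₂ wrapped = x , j , P-reflects-≤ (<⇒≤ x<N) Px≤Pj , inj₂ (sym Px+n≡Pj+m)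
      where
      Px+n≡Pj+m : P x + n ≡ P j + m
      Px+n≡Pj+m = trans (cong (_+ n) eq) wrapped
      Px≤Pj : P x ≤ P j
      Px≤Pj = +-cancelʳ-≤ n _ _ (subst (_≤ P j + n) (sym Px+n≡Pj+m) (+-monoʳ-≤ (P j) m≤n))

module AtMostTwo where
  open import Data.Nat using (_≤_; z≤n; s≤s)
  open import Data.Fin using (Fin)
  open import Data.Fin.Subset using (Subset; _∈_; _∉_)
  open import Data.List using (List; []; _∷_; length; filter; allFin; concatMap; cartesianProduct; map; _++_)
  open import Data.List.Relation.Unary.All as All using (All; _∷_)
  open import Data.List.Relation.Unary.All.Properties using (all-filter)
  open import Data.List.Relation.Unary.AllPairs using (_∷_)
  open import Data.List.Relation.Unary.Unique.Propositional using (Unique)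
  import Data.List.Relation.Unary.Unique.Propositional.Properties as Unique
  open import Data.Product using (_×_; _,_)
  open import Data.Sum using (_⊎_; inj₁; inj₂)
  open import Data.Empty using (⊥; ⊥-elim)
  open import Relation.Unary using (Pred; Decidable)
  open import Relation.Binary.PropositionalEquality using (_≡_; refl; cong)

  Subsingleton : {A : Set} → (A → Set) → Set
  Subsingleton R = ∀ {x y} → R x → R y → x ≡ y

  module _ {A : Set} {R₁ R₂ : A → Set} (R₁-unique : Subsingleton R₁) (R₂-unique : Subsingleton R₂) where

    length≤2 : (xs : List A) → Unique xs → All (λ x → R₁ x ⊎ R₂ x) xs → length xs ≤ 2
    length≤2 []               _ _ = z≤n
    length≤2 (_ ∷ [])         _ _ = s≤s z≤n
    length≤2 (_ ∷ _ ∷ [])     _ _ = s≤s (s≤s z≤n)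
    length≤2 (x ∷ y ∷ z ∷ _) ((x≢y ∷ x≢z ∷ _) ∷ (y≢z ∷ _) ∷ _) (rx ∷ ry ∷ rz ∷ _) =
      ⊥-elim (two-of-three rx ry rz)
      where
      two-of-three : R₁ x ⊎ R₂ x → R₁ y ⊎ R₂ y → R₁ z ⊎ R₂ z → ⊥
      two-of-three (inj₁ a) (inj₁ b) _        = x≢y (R₁-unique a b)
      two-of-three (inj₂ a) (inj₂ b) _        = x≢y (R₂-unique a b)
      two-of-three (inj₁ a) _        (inj₁ c) = x≢z (R₁-unique a c)
      two-of-three (inj₂ a) _        (inj₂ c) = x≢z (R₂-unique a c)
      two-of-three _        (inj₁ b) (inj₁ c) = y≢z (R₁-unique b c)
      two-of-three _        (inj₂ b) (inj₂ c) = y≢z (R₂-unique b c)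

    filter-length≤2 : ∀ {p} {P : Pred A p} (P? : Decidable P) (xs : List A) → Unique xs →
                      (∀ x → P x → R₁ x ⊎ R₂ x) → length (filter P? xs) ≤ 2
    filter-length≤2 P? xs xs-unique P⊆R =
      length≤2 (filter P? xs) (Unique.filter⁺ P? xs-unique) (All.map (P⊆R _) (all-filter P? xs))

  concatMap≡cartesianProduct : ∀ {A B : Set} (xs : List A) (ys : List B) →
    concatMap (λ u → map (u ,_) ys) xs ≡ cartesianProduct xs ys
  concatMap≡cartesianProduct []       ys = refl
  concatMap≡cartesianProduct (x ∷ xs) ys = cong (map (x ,_) ys ++_) (concatMap≡cartesianProduct xs ys)

  allPairs-unique : ∀ n → Unique (concatMap (λ u → map (u ,_) (allFin n)) (allFin n))
  allPairs-unique n rewrite concatMap≡cartesianProduct (allFin n) (allFin n) =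
    Unique.cartesianProduct⁺ (Unique.allFin⁺ n) (Unique.allFin⁺ n)

  eBW≤2 : ∀ {n} (G : Graph n) (B : Subset n) {R₁ R₂ : Fin n × Fin n → Set} →
          Subsingleton R₁ → Subsingleton R₂ →
          (∀ u w → u ∈ B → w ∉ B → Graph.Adj G u w → R₁ (u , w) ⊎ R₂ (u , w)) →
          eBW G B ≤ 2
  eBW≤2 {n} G B R₁-unique R₂-unique boundary⊆R =
    filter-length≤2 R₁-unique R₂-unique _ _ (allPairs-unique n)
      λ { (u , w) (u∈B , w∉B , u~w) → boundary⊆R u w u∈B w∉B u~w }

module Counting where
  open import Data.Nat using (ℕ; zero; suc; _+_; _≤_; z≤n; s≤s)
  open import Data.Nat.Properties using (≤-trans; m≤n+m)
  open import Data.Bool using (Bool; true; false)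
  open import Data.Fin using (Fin; zero; suc)
  open import Data.Fin.Subset using (_∈_; ∣_∣)
  open import Data.Vec using (tabulate)
  open import Data.Vec.Properties using ([]=⇒lookup; lookup⇒[]=; lookup∘tabulate)
  open import Relation.Binary.PropositionalEquality using (_≡_; refl; sym; trans; cong; cong₂)
  open import Data.Nat.Solver using (module +-*-Solver)
  open +-*-Solver using (solve; _:+_; _:=_)

  b2n : Bool → ℕ
  b2n true  = 1
  b2n false = 0

  card : ∀ {n} → (Fin n → Bool) → ℕ
  card {zero}  p = 0
  card {suc n} p = b2n (p zero) + card (λ i → p (suc i))

  card≡∣tabulate∣ : ∀ {n} (p : Fin n → Bool) → ∣ tabulate p ∣ ≡ card p
  card≡∣tabulate∣ {zero}  p = refl
  card≡∣tabulate∣ {suc n} p with p zero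
  ... | true  = cong suc (card≡∣tabulate∣ (λ i → p (suc i)))
  ... | false = card≡∣tabulate∣ (λ i → p (suc i))

  card-+ : ∀ {n} (p q r : Fin n → Bool) → (∀ v → b2n (p v) + b2n (q v) ≡ b2n (r v)) →
           card p + card q ≡ card r
  card-+ {zero}  p q r pq≡r = refl
  card-+ {suc n} p q r pq≡r =
    trans (interchange (b2n (p zero)) (card (λ i → p (suc i))) (b2n (q zero)) (card (λ i → q (suc i))))
          (cong₂ _+_ (pq≡r zero) (card-+ (λ i → p (suc i)) (λ i → q (suc i)) (λ i → r (suc i)) (λ v → pq≡r (suc v))))
    where
    interchange : ∀ a b c d → (a + b) + (c + d) ≡ (a + c) + (b + d)
    interchange = solve 4 (λ a b c d → (a :+ b) :+ (c :+ d) := (a :+ c) :+ (b :+ d)) refl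

  card-full : ∀ {n} (p : Fin n → Bool) → (∀ v → p v ≡ true) → card p ≡ n
  card-full {zero}  p all = refl
  card-full {suc n} p all rewrite all zero = cong suc (card-full (λ i → p (suc i)) (λ v → all (suc v)))

  card-witness : ∀ {n} (p : Fin n → Bool) v → p v ≡ true → 1 ≤ card p
  card-witness p zero pv rewrite pv = s≤s z≤n
  card-witness {suc n} p (suc v) pv = ≤-trans (card-witness (λ i → p (suc i)) v pv) (m≤n+m _ (b2n (p zero)))

  ∈tabulate⇒true : ∀ {n} (p : Fin n → Bool) v → v ∈ tabulate p → p v ≡ true
  ∈tabulate⇒true p v v∈ = trans (sym (lookup∘tabulate p v)) ([]=⇒lookup v∈)

  true⇒∈tabulate : ∀ {n} (p : Fin n → Bool) v → p v ≡ true → v ∈ tabulate p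
  true⇒∈tabulate p v pv = lookup⇒[]= v (tabulate p) (trans (lookup∘tabulate p v) pv)

module Intervals where
  open import Data.Nat using (ℕ; suc; pred; _+_; _≤_; _<_; _≤?_; _<?_)
  open import Data.Nat.Properties
  open import Data.Bool using (Bool; true; false)
  open import Data.Product using (_×_; _,_)
  open import Data.Sum using (_⊎_; inj₁; inj₂)
  open import Data.Empty using (⊥-elim)
  open import Relation.Nullary using (¬_; yes; no)
  open import Relation.Nullary.Decidable using (⌊_⌋)
  open import Relation.Binary.PropositionalEquality using (_≡_; refl; sym; cong)
  open Counting using (b2n)

  below : ℕ → ℕ → Bool
  below t x = ⌊ x <? t ⌋

  within : ℕ → ℕ → ℕ → Bool
  within a b x with a ≤? x | x <? b
  ... | yes _ | yes _ = true
  ... | _     | _     = false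

  below-complete : ∀ {x t} → x < t → below t x ≡ true
  below-complete {x} {t} x<t with x <? t
  ... | yes _   = refl
  ... | no  x≮t = ⊥-elim (x≮t x<t)

  within-sound : ∀ a b x → within a b x ≡ true → a ≤ x × x < b
  within-sound a b x _ with a ≤? x | x <? b
  within-sound a b x _  | yes a≤x | yes x<b = a≤x , x<b

  within-complete : ∀ {a b x} → a ≤ x → x < b → within a b x ≡ true
  within-complete {a} {b} {x} a≤x x<b with a ≤? x | x <? b
  ... | yes _   | yes _   = refl
  ... | no  a≰x | _       = ⊥-elim (a≰x a≤x)
  ... | yes _   | no  x≮b = ⊥-elim (x≮b x<b)

  within+below : ∀ {a b} x → a ≤ b → b2n (within a b x) + b2n (below a x) ≡ b2n (below b x)
  within+below {a} {b} x a≤b with a ≤? x | x <? b | x <? a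
  ... | yes a≤x | _       | yes x<a = ⊥-elim (<⇒≱ x<a a≤x)
  ... | yes _   | yes _   | no  _   = refl
  ... | yes _   | no  _   | no  _   = refl
  ... | no  _   | yes _   | yes _   = refl
  ... | no  a≰x | _       | no  x≮a = ⊥-elim (a≰x (≮⇒≥ x≮a))
  ... | no  _   | no  x≮b | yes x<a = ⊥-elim (x≮b (<-≤-trans x<a a≤b))

  leave-interval : ∀ {a b x y} → a ≤ x → x < b → ¬ (a ≤ y × y < b) → (y ≡ suc x ⊎ x ≡ suc y) →
                   (x ≡ a × y ≡ pred a) ⊎ (x ≡ pred b × y ≡ b)
  leave-interval {a} {b} {x} a≤x x<b y∉ (inj₁ refl) with suc x <? b
  ... | yes x+1<b = ⊥-elim (y∉ (≤-trans a≤x (n≤1+n x) , x+1<b))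
  ... | no  x+1≮b = inj₂ (cong pred x+1≡b , x+1≡b)
    where
    x+1≡b : suc x ≡ b
    x+1≡b = ≤-antisym x<b (≮⇒≥ x+1≮b)
  leave-interval {a} {b} {y = y} a≤x x<b y∉ (inj₂ refl) with a ≤? y
  ... | yes a≤y = ⊥-elim (y∉ (a≤y , <-trans (n<1+n y) x<b))
  ... | no  a≰y = inj₁ (sym a≡y+1 , cong pred (sym a≡y+1))
    where
    a≡y+1 : a ≡ suc y
    a≡y+1 = ≤-antisym a≤x (≰⇒> a≰y)

record Layering {n : ℕ} (G : Graph n) (N : ℕ) : Set where
  open Graph G using (Adj)
  field
    layer              : Fin n → ℕ
    layer<N            : ∀ v → layer v < N
    layer-onto         : ∀ t → t < N → Σ (Fin n) λ v → layer v ≡ t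
    crossing-adjacent  : ∀ {u w} → Adj u w → layer u ≢ layer w →
                         layer w ≡ suc (layer u) ⊎ layer u ≡ suc (layer w)
    crossing-injective : ∀ {u w u′ w′} → Adj u w → layer u ≢ layer w → Adj u′ w′ → layer u′ ≢ layer w′ →
                         layer u ≡ layer u′ → u ≡ u′

-- If n < 2N, a layering of height N yields, for every m ≤ n, a set of m
-- vertices with at most two boundary edges: a union of consecutive layers
-- or the complement of one, whose boundary edges cross its two end layers.
module LayeredCut {n : ℕ} (G : Graph n) {N : ℕ} (L : Layering G N) where
  open import Data.Nat using (ℕ; suc; pred; _+_; _∸_; _≤_; _<_; s≤s)
  open import Data.Nat.Properties using (n≤1+n; ≤-reflexive; +-monoˡ-≤; +-cancelʳ-≡; +-comm; +-assoc; m+n∸m≡n)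
  open import Data.Fin using (Fin)
  open import Data.Bool using (Bool)
  open import Data.Fin.Subset using (Subset; _∈_; _∉_; ∣_∣; ∁)
  open import Data.Vec using (tabulate)
  open import Data.Product using (Σ; _×_; _,_; proj₁; proj₂)
  open import Data.Sum as Sum using (_⊎_; inj₁; inj₂)
  open import Data.Fin.Subset.Properties using (∣∁p∣≡n∸∣p∣; x∈∁p⇒x∉p; x∉∁p⇒x∈p)
  open import Function using (_∘_)
  open import Relation.Nullary using (¬_)
  open import Relation.Binary.PropositionalEquality using (_≡_; _≢_; refl; sym; trans; cong; cong₂; subst; module ≡-Reasoning)
  open Graph G using (Adj) renaming (sym to adj-sym)
  open Layering L
  open Counting
  open Intervals
  open AtMostTwo using (Subsingleton; eBW≤2)
  open Arithmetic using (step-increasing⇒monotone; gap-or-cogap)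
  open ≡-Reasoning

  Crossing : ℕ → ℕ → Fin n × Fin n → Set
  Crossing c d (u , w) = Adj u w × layer u ≢ layer w × layer u ≡ c × layer w ≡ d

  crossing-unique : ∀ {c d} → Subsingleton (Crossing c d)
  crossing-unique (u~w , u≁w , refl , refl) (u′~w′ , u′≁w′ , u′≡ , w′≡) =
    cong₂ _,_ (crossing-injective u~w u≁w u′~w′ u′≁w′ (sym u′≡))
              (crossing-injective (adj-sym u~w) (u≁w ∘ sym) (adj-sym u′~w′) (u′≁w′ ∘ sym) (sym w′≡))

  inI : ℕ → ℕ → Fin n → Bool
  inI a b v = within a b (layer v)

  I : ℕ → ℕ → Subset n
  I a b = tabulate (inI a b)

  P : ℕ → ℕ
  P t = card (λ v → below t (layer v))

  P-top : P N ≡ n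
  P-top = card-full _ (λ v → below-complete (layer<N v))

  ∣I∣+P : ∀ {a b} → a ≤ b → ∣ I a b ∣ + P a ≡ P b
  ∣I∣+P {a} {b} a≤b = trans (cong (_+ P a) (card≡∣tabulate∣ (inI a b))) (card-+ (inI a b) _ _ (λ v → within+below (layer v) a≤b))

  -- every layer below N is inhabited
  P-step : ∀ t → t < N → P t < P (suc t)
  P-step t t<N with v , layer-v≡t ← layer-onto t t<N =
    subst (suc (P t) ≤_) (∣I∣+P (n≤1+n t))
      (+-monoˡ-≤ (P t) (subst (1 ≤_) (sym (card≡∣tabulate∣ (inI t (suc t))))
        (card-witness (inI t (suc t)) v (within-complete (≤-reflexive (sym layer-v≡t)) (s≤s (≤-reflexive layer-v≡t))))))

  P-mono : ∀ {a b} → a < b → b ≤ N → P a < P b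
  P-mono = step-increasing⇒monotone P P-step

  leaving-I : ∀ {a b u w} → u ∈ I a b → w ∉ I a b → Adj u w →
              Crossing a (pred a) (u , w) ⊎ Crossing (pred b) b (u , w)
  leaving-I {a} {b} {u} {w} u∈I w∉I u~w =
    ends (leave-interval (proj₁ u-inside) (proj₂ u-inside) w-outside (crossing-adjacent u~w u≁w))
    where
    u-inside : a ≤ layer u × layer u < b
    u-inside = within-sound a b (layer u) (∈tabulate⇒true (inI a b) u u∈I)
    w-outside : ¬ (a ≤ layer w × layer w < b)
    w-outside (a≤w , w<b) = w∉I (true⇒∈tabulate (inI a b) w (within-complete a≤w w<b))
    u≁w : layer u ≢ layer w
    u≁w eq = w-outside (subst (λ l → a ≤ l × l < b) eq u-inside)
    ends : (layer u ≡ a × layer w ≡ pred a) ⊎ (layer u ≡ pred b × layer w ≡ b) →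
           Crossing a (pred a) (u , w) ⊎ Crossing (pred b) b (u , w)
    ends (inj₁ (u≡a , w≡a-1)) = inj₁ (u~w , u≁w , u≡a , w≡a-1)
    ends (inj₂ (u≡b-1 , w≡b)) = inj₂ (u~w , u≁w , u≡b-1 , w≡b)

  I-eBW≤2 : ∀ a b → eBW G (I a b) ≤ 2
  I-eBW≤2 a b = eBW≤2 G (I a b) crossing-unique crossing-unique (λ u w → leaving-I)

  -- boundary edges of the complement are reversed boundary edges of I a b
  ∁I-eBW≤2 : ∀ a b → eBW G (∁ (I a b)) ≤ 2
  ∁I-eBW≤2 a b = eBW≤2 G (∁ (I a b)) crossing-unique crossing-unique entering
    where
    reverse : ∀ {c d u w} → Crossing c d (w , u) → Crossing d c (u , w)
    reverse (w~u , w≁u , w≡c , u≡d) = adj-sym w~u , w≁u ∘ sym , u≡d , w≡c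
    entering : ∀ u w → u ∈ ∁ (I a b) → w ∉ ∁ (I a b) → Adj u w →
               Crossing (pred a) a (u , w) ⊎ Crossing b (pred b) (u , w)
    entering u w u∈∁I w∉∁I u~w =
      Sum.map reverse reverse (leaving-I (x∉∁p⇒x∈p w∉∁I) (x∈∁p⇒x∉p u∈∁I) (adj-sym u~w))

  interval-cut : ∀ m {a b} → a ≤ b → P a + m ≡ P b → Σ (Subset n) λ B → ∣ B ∣ ≡ m × eBW G B ≤ 2
  interval-cut m {a} {b} a≤b Pa+m≡Pb = I a b , ∣I∣≡m , I-eBW≤2 a b
    where
    ∣I∣≡m : ∣ I a b ∣ ≡ m
    ∣I∣≡m = +-cancelʳ-≡ (P a) _ _ (trans (∣I∣+P a≤b) (trans (sym Pa+m≡Pb) (+-comm (P a) m)))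

  cointerval-cut : ∀ m {a b} → a ≤ b → P b + m ≡ P a + n → Σ (Subset n) λ B → ∣ B ∣ ≡ m × eBW G B ≤ 2
  cointerval-cut m {a} {b} a≤b Pb+m≡Pa+n = ∁ (I a b) , ∣∁I∣≡m , ∁I-eBW≤2 a b
    where
    ∣I∣+m≡n : ∣ I a b ∣ + m ≡ n
    ∣I∣+m≡n = +-cancelʳ-≡ (P a) _ _ (begin
      ∣ I a b ∣ + m + P a   ≡⟨ +-assoc ∣ I a b ∣ m (P a) ⟩
      ∣ I a b ∣ + (m + P a) ≡⟨ cong (∣ I a b ∣ +_) (+-comm m (P a)) ⟩
      ∣ I a b ∣ + (P a + m) ≡⟨ sym (+-assoc ∣ I a b ∣ (P a) m) ⟩
      ∣ I a b ∣ + P a + m   ≡⟨ cong (_+ m) (∣I∣+P a≤b) ⟩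
      P b + m               ≡⟨ Pb+m≡Pa+n ⟩
      P a + n               ≡⟨ +-comm (P a) n ⟩
      n + P a               ∎)
    ∣∁I∣≡m : ∣ ∁ (I a b) ∣ ≡ m
    ∣∁I∣≡m = begin
      ∣ ∁ (I a b) ∣             ≡⟨ ∣∁p∣≡n∸∣p∣ (I a b) ⟩
      n ∸ ∣ I a b ∣             ≡⟨ cong (_∸ ∣ I a b ∣) (sym ∣I∣+m≡n) ⟩
      ∣ I a b ∣ + m ∸ ∣ I a b ∣ ≡⟨ m+n∸m≡n ∣ I a b ∣ m ⟩
      m                         ∎

  cut : n < N + N → ∀ m → m ≤ n → Σ (Subset n) λ B → ∣ B ∣ ≡ m × eBW G B ≤ 2
  cut n<2N m m≤n = from-gap (gap-or-cogap P P-mono P-top n<2N m m≤n)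
    where
    from-gap : (Σ ℕ λ a → Σ ℕ λ b → a ≤ b × (P a + m ≡ P b ⊎ P b + m ≡ P a + n)) →
               Σ (Subset n) λ B → ∣ B ∣ ≡ m × eBW G B ≤ 2
    from-gap (a , b , a≤b , inj₁ gap)   = interval-cut m a≤b gap
    from-gap (a , b , a≤b , inj₂ cogap) = cointerval-cut m a≤b cogap

module Forests where
  open import Data.Nat using (ℕ; zero; suc; pred; _+_; _*_; _<_; z≤n; s≤s)
  open import Data.Nat.Properties using (*-identityˡ)
  open import Data.Nat.ListAction using (sum)
  open import Data.Fin using (Fin)
  import Data.Fin
  import Data.Fin.Properties as FinP
  open import Data.List using (List; []; _∷_; _++_; [_]; length; concat; tabulate)
  open import Data.List.Properties using (length-++)
  open import Data.List.Relation.Unary.All as All using (All; []; _∷_)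
  open import Data.List.Relation.Unary.AllPairs using ([]; _∷_)
  open import Data.List.Relation.Unary.All.Properties using (¬Any⇒All¬)
  open import Data.List.Relation.Unary.Any using (here; there)
  open import Data.List.Relation.Unary.Linked using (Linked; []; [-]; _∷_)
  open import Data.List.Relation.Unary.Unique.Propositional using (Unique)
  open import Data.List.Membership.Propositional using (_∈_)
  open import Data.Product using (Σ; _×_; _,_; proj₁; proj₂)
  open import Data.Sum as Sum using (_⊎_; inj₁; inj₂)
  open import Data.Empty using (⊥; ⊥-elim)
  open import Relation.Nullary using (¬_; Dec; yes; no; _⊎-dec_)
  open import Function using (_∘_)
  open import Relation.Binary using (DecidableEquality)
  open import Relation.Binary.Construct.Closure.ReflexiveTransitive as Star using (Star; ε; _◅_; _◅◅_)
  open import Relation.Binary.PropositionalEquality using (_≡_; _≢_; refl; sym; trans; cong; cong₂)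

  -- Loop erasure: every walk contains a simple path with the same ends.
  module SimplePaths {A : Set} (_≟_ : DecidableEquality A) where
    open import Data.List.Membership.DecPropositional _≟_ using (_∈?_)

    EndsAt : A → List A → A → Set
    EndsAt x []       y = x ≡ y
    EndsAt x (z ∷ zs) y = EndsAt z zs y

    record SimplePath (E : A → A → Set) (x y : A) : Set where
      constructor simple
      field
        rest   : List A
        unique : Unique (x ∷ rest)
        linked : Linked E (x ∷ rest)
        ends   : EndsAt x rest y

    suffix : ∀ {E y} x v vs → x ∈ v ∷ vs → Unique (v ∷ vs) → Linked E (v ∷ vs) → EndsAt v vs y →
             SimplePath E x y
    suffix x v vs       (here refl) vs-unique vs-linked ends = simple vs vs-unique vs-linked ends
    suffix x v (w ∷ ws) (there x∈) (_ ∷ ws-unique) (_ ∷ ws-linked) ends = suffix x w ws x∈ ws-unique ws-linked ends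

    shorten : ∀ {E x y} → Star E x y → SimplePath E x y
    shorten ε = simple [] ([] ∷ []) [-] refl
    shorten {x = x} (_◅_ {j = v} x~v walk) with shorten walk
    ... | simple vs vs-unique vs-linked ends with x ∈? v ∷ vs
    ... | yes x∈ = suffix x v vs x∈ vs-unique vs-linked ends
    ... | no  x∉ = simple (v ∷ vs) (¬Any⇒All¬ _ x∉ ∷ vs-unique) (x~v ∷ vs-linked) ends

  module Reachability {n : ℕ} (G : Graph n) where
    open Graph G using (Adj) renaming (sym to adj-sym)

    conn⇒walk : ∀ {u v} → Conn G u v → Star Adj u v
    conn⇒walk here         = ε
    conn⇒walk (step u~ c) = u~ ◅ conn⇒walk c

    walk⇒conn : ∀ {u v} → Star Adj u v → Conn G u v
    walk⇒conn ε          = here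
    walk⇒conn (u~ ◅ w) = step u~ (walk⇒conn w)

    conn-sym : ∀ {u v} → Conn G u v → Conn G v u
    conn-sym c = walk⇒conn (Star.reverse adj-sym (conn⇒walk c))

    conn-trans : ∀ {u v w} → Conn G u v → Conn G v w → Conn G u w
    conn-trans c d = walk⇒conn (conn⇒walk c ◅◅ conn⇒walk d)

    chain⇒linked : ∀ {xs} → Chain G xs → Linked Adj xs
    chain⇒linked []       = []
    chain⇒linked [-]      = [-]
    chain⇒linked (e ∷ c) = e ∷ chain⇒linked c

  module Bridges {n : ℕ} (G : Graph n) where
    open Graph G using (Adj; irrefl) renaming (sym to adj-sym)
    open SimplePaths (Data.Fin._≟_ {n})

    Avoiding : Fin n → Fin n → Fin n → Fin n → Set
    Avoiding x y u v = Adj u v × ¬ (u ≡ x × v ≡ y) × ¬ (u ≡ y × v ≡ x)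

    avoiding-sym : ∀ {x y u v} → Avoiding x y u v → Avoiding x y v u
    avoiding-sym (u~v , not-xy , not-yx) =
      adj-sym u~v , (λ { (v≡x , u≡y) → not-yx (u≡y , v≡x) }) , (λ { (v≡y , u≡x) → not-xy (u≡x , v≡y) })

    close : ∀ {x y} a as → Linked (Avoiding x y) (a ∷ as) → EndsAt a as y → Adj y x → Chain G (a ∷ as ++ [ x ])
    close a []       [-]              refl y~x = y~x ∷ [-]
    close a (b ∷ bs) ((a~b , _) ∷ c) ends y~x = a~b ∷ close b bs c ends y~x

    -- a shortest avoiding walk from x to y is either the edge itself (excluded)
    -- or has at least two inner steps and closes to a cycle
    edge-is-bridge : Forest G → ∀ {x y} → Adj x y → Star (Avoiding x y) x y → ⊥
    edge-is-bridge forest {x} {y} x~y walk with shorten walk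
    ... | simple []           _ _                          refl = irrefl x~y
    ... | simple (_ ∷ [])     _ ((_ , not-xy , _) ∷ [-]) refl = not-xy (refl , refl)
    ... | simple (z₁ ∷ z₂ ∷ zs) unique linked ends =
          forest x (z₁ ∷ z₂ ∷ zs) (s≤s (s≤s z≤n) , unique , close x (z₁ ∷ z₂ ∷ zs) linked ends (adj-sym x~y))

  module Lists {A : Set} (_≟_ : DecidableEquality A) where

    data Consecutive : List A → A → A → Set where
      here  : ∀ {x y xs} → Consecutive (x ∷ y ∷ xs) x y
      there : ∀ {x xs u v} → Consecutive xs u v → Consecutive (x ∷ xs) u v

    consecutive-∈ˡ : ∀ {ℓ u v} → Consecutive ℓ u v → u ∈ ℓ
    consecutive-∈ˡ here      = here refl
    consecutive-∈ˡ (there c) = there (consecutive-∈ˡ c)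

    consecutive-∈ʳ : ∀ {ℓ u v} → Consecutive ℓ u v → v ∈ ℓ
    consecutive-∈ʳ here      = there (here refl)
    consecutive-∈ʳ (there c) = there (consecutive-∈ʳ c)

    linked-consecutive : ∀ {R : A → A → Set} {ℓ u v} → Linked R ℓ → Consecutive ℓ u v → R u v
    linked-consecutive (r ∷ _)      here      = r
    linked-consecutive (_ ∷ linked) (there c) = linked-consecutive linked c
    linked-consecutive [-]          (there ())

    consecutive? : ∀ ℓ u v → Dec (Consecutive ℓ u v)
    consecutive? []           u v = no λ ()
    consecutive? (x ∷ [])     u v = no λ { (there ()) }
    consecutive? (x ∷ y ∷ xs) u v with consecutive? (y ∷ xs) u v | u ≟ x | v ≟ y
    ... | yes c | _        | _        = yes (there c)
    ... | no  _ | yes refl | yes refl = yes here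
    ... | no ¬c | no  u≢x  | _        = no λ { here → u≢x refl ; (there c) → ¬c c }
    ... | no ¬c | yes _    | no  v≢y  = no λ { here → v≢y refl ; (there c) → ¬c c }

    consecutive-++ˡ : ∀ {xs ys u v} → Consecutive xs u v → Consecutive (xs ++ ys) u v
    consecutive-++ˡ here      = here
    consecutive-++ˡ (there c) = there (consecutive-++ˡ c)

    consecutive-++ʳ : ∀ xs {ys u v} → Consecutive ys u v → Consecutive (xs ++ ys) u v
    consecutive-++ʳ []       c = c
    consecutive-++ʳ (x ∷ xs) c = there (consecutive-++ʳ xs c)

    consecutive-concat : ∀ {k} (L : Fin k → List A) i {u v} →
                         Consecutive (L i) u v → Consecutive (concat (tabulate L)) u v
    consecutive-concat L Fin.zero    c = consecutive-++ˡ c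
    consecutive-concat L (Fin.suc i) c = consecutive-++ʳ (L Fin.zero) (consecutive-concat (λ j → L (Fin.suc j)) i c)

    length-concat : ∀ {k} (L : Fin k → List A) → length (concat (tabulate L)) ≡ sum (tabulate (λ i → length (L i)))
    length-concat {zero}  L = refl
    length-concat {suc k} L =
      trans (length-++ (L Fin.zero)) (cong (length (L Fin.zero) +_) (length-concat (λ j → L (Fin.suc j))))

    -- the position of the first occurrence of x in ys (length ys if absent)
    position : A → List A → ℕ
    position x []       = 0
    position x (y ∷ ys) with x ≟ y
    ... | yes _ = 0
    ... | no  _ = suc (position x ys)

    position-head : ∀ y ys → position y (y ∷ ys) ≡ 0
    position-head y ys with y ≟ y
    ... | yes _   = refl
    ... | no  y≢y = ⊥-elim (y≢y refl)

    position-tail : ∀ {x} y ys → x ≢ y → position x (y ∷ ys) ≡ suc (position x ys)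
    position-tail {x} y ys x≢y with x ≟ y
    ... | yes x≡y = ⊥-elim (x≢y x≡y)
    ... | no  _   = refl

    position<length : ∀ {x ys} → x ∈ ys → position x ys < length ys
    position<length {x} {y ∷ ys} x∈ with x ≟ y | x∈
    ... | yes _   | _         = s≤s z≤n
    ... | no  x≢y | here x≡y  = ⊥-elim (x≢y x≡y)
    ... | no  _   | there x∈′ = s≤s (position<length x∈′)

    position-injective : ∀ {x z ys} → x ∈ ys → z ∈ ys → position x ys ≡ position z ys → x ≡ z
    position-injective {x} {z} {y ∷ ys} x∈ z∈ eq with x ≟ y | z ≟ y | x∈ | z∈
    ... | yes refl | yes refl | _          | _          = refl
    ... | no  x≢y  | no  z≢y  | here x≡y   | _          = ⊥-elim (x≢y x≡y)
    ... | no  x≢y  | no  z≢y  | there _    | here z≡y   = ⊥-elim (z≢y z≡y)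
    ... | no  x≢y  | no  z≢y  | there x∈′  | there z∈′  = position-injective x∈′ z∈′ (cong pred eq)
    position-injective {x} {z} {y ∷ ys} x∈ z∈ () | yes _ | no _ | _ | _
    position-injective {x} {z} {y ∷ ys} x∈ z∈ () | no _ | yes _ | _ | _

    position-onto : ∀ {ys} → Unique ys → ∀ t → t < length ys → Σ A λ x → x ∈ ys × position x ys ≡ t
    position-onto {y ∷ ys} _ zero _ = y , here refl , position-head y ys
    position-onto {y ∷ ys} (y∉ys ∷ ys-unique) (suc t) (s≤s t<) with position-onto ys-unique t t<
    ... | x , x∈ , pos≡t with x ≟ y
    ... | yes refl = ⊥-elim (All.lookup y∉ys x∈ refl)
    ... | no  x≢y  = x , there x∈ , trans (position-tail y ys x≢y) (cong suc pos≡t)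

    position-consecutive : ∀ {ys u v} → Unique ys → Consecutive ys u v → position v ys ≡ suc (position u ys)
    position-consecutive {x ∷ y ∷ xs} ((x≢y ∷ _) ∷ _) here =
      trans (position-tail x (y ∷ xs) (x≢y ∘ sym))
            (trans (cong suc (position-head y xs)) (cong suc (sym (position-head x (y ∷ xs)))))
    position-consecutive {x ∷ xs} (x∉xs ∷ xs-unique) (there c) =
      trans (position-tail x xs (λ { refl → All.lookup x∉xs (consecutive-∈ʳ c) refl }))
            (trans (cong suc (position-consecutive xs-unique c))
                   (cong suc (sym (position-tail x xs (λ { refl → All.lookup x∉xs (consecutive-∈ˡ c) refl })))))

  module PathSegments {n : ℕ} (G : Graph n) where
    open Graph G using (Adj) renaming (sym to adj-sym)
    open Lists (Data.Fin._≟_ {n})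
    open Bridges G using (Avoiding; avoiding-sym)

    EdgeIn : List (Fin n) → Fin n → Fin n → Set
    EdgeIn ℓ u v = Adj u v × u ∈ ℓ × v ∈ ℓ

    along : ∀ b bs {q} → Linked Adj (b ∷ bs) → q ∈ b ∷ bs → Star (EdgeIn (b ∷ bs)) b q
    along b bs       c             (here refl) = ε
    along b (b′ ∷ bs) (b~b′ ∷ c) (there q∈) =
      (b~b′ , here refl , there (here refl)) ◅ Star.map (λ { (e , u∈ , v∈) → e , there u∈ , there v∈ }) (along b′ bs c q∈)

    edgeIn⇒avoiding : ∀ {a b bs} → All (a ≢_) (b ∷ bs) → ∀ {u v} → EdgeIn (b ∷ bs) u v → Avoiding a b u v
    edgeIn⇒avoiding a∉ (u~v , u∈ , v∈) =
      u~v , (λ { (refl , _) → All.lookup a∉ u∈ refl }) , (λ { (_ , refl) → All.lookup a∉ v∈ refl })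

    segment : ∀ ℓ → Unique ℓ → Linked Adj ℓ → ∀ {p q} → p ∈ ℓ → q ∈ ℓ → p ≢ q →
              (Σ (Fin n) λ y → Consecutive ℓ p y × Star (Avoiding p y) q y) ⊎
              (Σ (Fin n) λ y → Consecutive ℓ q y × Star (Avoiding q y) p y)
    segment (a ∷ as)      _ _ (here refl) (here refl) p≢q = ⊥-elim (p≢q refl)
    segment (a ∷ [])      _ _ (here refl) (there ())  _
    segment (a ∷ [])      _ _ (there ())  _           _
    segment (a ∷ b ∷ bs) (a∉ ∷ _) (_ ∷ c) (here refl) (there q∈) _ =
      inj₁ (b , here , Star.reverse avoiding-sym (Star.map (edgeIn⇒avoiding a∉) (along b bs c q∈)))
    segment (a ∷ b ∷ bs) (a∉ ∷ _) (_ ∷ c) (there p∈) (here refl) _ =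
      inj₂ (b , here , Star.reverse avoiding-sym (Star.map (edgeIn⇒avoiding a∉) (along b bs c p∈)))
    segment (a ∷ b ∷ bs) (_ ∷ unique) (_ ∷ c) (there p∈) (there q∈) p≢q with segment (b ∷ bs) unique c p∈ q∈ p≢q
    ... | inj₁ (y , cons , walk) = inj₁ (y , there cons , walk)
    ... | inj₂ (y , cons , walk) = inj₂ (y , there cons , walk)

  -- Every
  -- vertex v is anchored at the first vertex of Π met on a walk from v to its
  -- component's path; such a walk uses no path edge.  Since every edge is a bridge, only path edges
  -- join vertices with different anchors.
  module PathLayering {n : ℕ} (G : Graph n) (forest : Forest G)
      {k : ℕ} (s : Fin k → Fin n) (ps : Fin k → List (Fin n))
      (isPath : ∀ i → IsPath G (s i) (ps i))
      (apart : ∀ i j → i ≢ j → ¬ Conn G (s i) (s j))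
      (cover : ∀ v → Σ (Fin k) λ i → Conn G v (s i)) where
    open Graph G using (Adj) renaming (sym to adj-sym)
    open Reachability G
    open Bridges G using (Avoiding; edge-is-bridge)
    open PathSegments G using (along; segment)
    open Lists (Data.Fin._≟_ {n})
    open import Data.List.Membership.DecPropositional (Data.Fin._≟_ {n}) using (_∈?_)
    open import Data.List.Membership.Propositional.Properties using (∈-concat⁺; ∈-concat⁻)
    import Data.List.Relation.Unary.Any.Properties as Any
    import Data.List.Relation.Unary.All.Properties as All
    import Data.List.Relation.Unary.AllPairs.Properties as AllPairs
    import Data.List.Relation.Unary.Unique.Propositional.Properties as Unique

    path : Fin k → List (Fin n)
    path i = s i ∷ ps i

    Π : List (Fin n)
    Π = concat (tabulate path)

    ∈Π⁺ : ∀ i {x} → x ∈ path i → x ∈ Π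
    ∈Π⁺ i x∈ = ∈-concat⁺ (Any.tabulate⁺ i x∈)

    ∈Π⁻ : ∀ {x} → x ∈ Π → Σ (Fin k) λ i → x ∈ path i
    ∈Π⁻ x∈ = Any.tabulate⁻ (∈-concat⁻ (tabulate path) x∈)

    consecutive-Π : ∀ i {u v} → Consecutive (path i) u v → Consecutive Π u v
    consecutive-Π = consecutive-concat path

    length-Π : length Π ≡ sum (tabulate (λ i → pathSize G (s i) (ps i)))
    length-Π = length-concat path

    twice-length-Π : 2 * sum (tabulate (λ i → pathSize G (s i) (ps i))) ≡ length Π + length Π
    twice-length-Π = trans (cong (S +_) (*-identityˡ S)) (cong₂ _+_ (sym length-Π) (sym length-Π))
      where
      S : ℕ
      S = sum (tabulate (λ i → pathSize G (s i) (ps i)))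

    path-conn : ∀ i {x} → x ∈ path i → Conn G (s i) x
    path-conn i x∈ = walk⇒conn (Star.map proj₁ (along (s i) (ps i) (chain⇒linked (proj₂ (isPath i))) x∈))

    same-path : ∀ {i j x y} → x ∈ path i → y ∈ path j → Conn G x y → i ≡ j
    same-path {i} {j} x∈ y∈ x~y with i Data.Fin.≟ j
    ... | yes i≡j = i≡j
    ... | no  i≢j = ⊥-elim (apart i j i≢j (conn-trans (path-conn i x∈) (conn-trans x~y (conn-sym (path-conn j y∈)))))

    -- the paths are vertex-disjoint, so Π has no repetitions
    Π-unique : Unique Π
    Π-unique = Unique.concat⁺ (All.tabulate⁺ (λ i → proj₁ (isPath i)))
      (AllPairs.tabulate⁺-< λ i<j (x∈ , x∈′) → FinP.<⇒≢ i<j (same-path x∈ x∈′ here))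

    linked : ∀ i → Linked Adj (path i)
    linked i = chain⇒linked (proj₂ (isPath i))

    PathEdge : Fin n → Fin n → Set
    PathEdge u v = Σ (Fin k) λ i → Consecutive (path i) u v ⊎ Consecutive (path i) v u

    pathEdge? : ∀ u v → Dec (PathEdge u v)
    pathEdge? u v = FinP.any? (λ i → consecutive? (path i) u v ⊎-dec consecutive? (path i) v u)

    pathEdge-sym : ∀ {u v} → PathEdge u v → PathEdge v u
    pathEdge-sym (i , c) = i , Sum.swap c

    pathEdge-∈Π : ∀ {u v} → PathEdge u v → u ∈ Π
    pathEdge-∈Π (i , inj₁ c) = ∈Π⁺ i (consecutive-∈ˡ c)
    pathEdge-∈Π (i , inj₂ c) = ∈Π⁺ i (consecutive-∈ʳ c)

    OffPath : Fin n → Fin n → Set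
    OffPath u v = Adj u v × ¬ PathEdge u v

    offPath-sym : ∀ {u v} → OffPath u v → OffPath v u
    offPath-sym (u~v , ¬pe) = adj-sym u~v , ¬pe ∘ pathEdge-sym

    offPath⇒avoiding : ∀ {x y} → PathEdge x y → ∀ {u v} → OffPath u v → Avoiding x y u v
    offPath⇒avoiding pe (u~v , ¬pe) = u~v , (λ { (refl , refl) → ¬pe pe }) , (λ { (refl , refl) → ¬pe (pathEdge-sym pe) })

    -- Distinct vertices of Π are never joined by an off-path walk: they would
    -- lie on one path, and the walk together with a segment of that path would
    -- avoid a path edge between its ends.
    no-off-path-walk : ∀ {p q} → p ∈ Π → q ∈ Π → p ≢ q → Star OffPath p q → ⊥
    no-off-path-walk p∈ q∈ p≢q walk with ∈Π⁻ p∈ | ∈Π⁻ q∈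
    ... | i , p∈i | j , q∈j with same-path p∈i q∈j (walk⇒conn (Star.map proj₁ walk))
    ... | refl with segment (path i) (proj₁ (isPath i)) (linked i) p∈i q∈j p≢q
    ... | inj₁ (y , p→y , q⇝y) = edge-is-bridge forest (linked-consecutive (linked i) p→y)
            (Star.map (offPath⇒avoiding (i , inj₁ p→y)) walk ◅◅ q⇝y)
    ... | inj₂ (y , q→y , p⇝y) = edge-is-bridge forest (linked-consecutive (linked i) q→y)
            (Star.map (offPath⇒avoiding (i , inj₁ q→y)) (Star.reverse offPath-sym walk) ◅◅ p⇝y)

    first-on-Π : ∀ {u w} → Conn G u w → w ∈ Π → Σ (Fin n) λ x → x ∈ Π × Star OffPath u x × (u ∈ Π → x ≡ u)
    first-on-Π here w∈ = _ , w∈ , ε , λ _ → refl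
    first-on-Π {u} (step u~v c) w∈ with u ∈? Π
    ... | yes u∈ = u , u∈ , ε , λ _ → refl
    ... | no  u∉ with x , x∈ , walk , _ ← first-on-Π c w∈ =
          x , x∈ , (u~v , u∉ ∘ pathEdge-∈Π) ◅ walk , λ u∈ → ⊥-elim (u∉ u∈)

    anchoring : ∀ v → Σ (Fin n) λ x → x ∈ Π × Star OffPath v x × (v ∈ Π → x ≡ v)
    anchoring v = first-on-Π (proj₂ (cover v)) (∈Π⁺ (proj₁ (cover v)) (here refl))

    anchor : Fin n → Fin n
    anchor v = proj₁ (anchoring v)

    anchor-∈Π : ∀ v → anchor v ∈ Π
    anchor-∈Π v = proj₁ (proj₂ (anchoring v))

    anchor-walk : ∀ v → Star OffPath v (anchor v)
    anchor-walk v = proj₁ (proj₂ (proj₂ (anchoring v)))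

    anchor-on-Π : ∀ {v} → v ∈ Π → anchor v ≡ v
    anchor-on-Π {v} = proj₂ (proj₂ (proj₂ (anchoring v)))

    off-path-same-anchor : ∀ {u w} → OffPath u w → anchor u ≡ anchor w
    off-path-same-anchor {u} {w} u~w with anchor u Data.Fin.≟ anchor w
    ... | yes same = same
    ... | no  different = ⊥-elim (no-off-path-walk (anchor-∈Π u) (anchor-∈Π w) different
            (Star.reverse offPath-sym (anchor-walk u) ◅◅ u~w ◅ anchor-walk w))

    layer : Fin n → ℕ
    layer v = position (anchor v) Π

    layer-on-Π : ∀ {v} → v ∈ Π → layer v ≡ position v Π
    layer-on-Π v∈ = cong (λ x → position x Π) (anchor-on-Π v∈)

    crossing⇒pathEdge : ∀ {u w} → Adj u w → layer u ≢ layer w → PathEdge u w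
    crossing⇒pathEdge {u} {w} u~w u≁w with pathEdge? u w
    ... | yes pe = pe
    ... | no ¬pe = ⊥-elim (u≁w (cong (λ x → position x Π) (off-path-same-anchor (u~w , ¬pe))))

    consecutive-layers : ∀ i {u w} → Consecutive (path i) u w → layer w ≡ suc (layer u)
    consecutive-layers i u→w =
      trans (layer-on-Π (∈Π⁺ i (consecutive-∈ʳ u→w)))
        (trans (position-consecutive Π-unique (consecutive-Π i u→w))
               (cong suc (sym (layer-on-Π (∈Π⁺ i (consecutive-∈ˡ u→w))))))

    -- the layers form a layering of height |Π|: path edges link consecutive
    -- positions, and vertices on Π are determined by their positions
    layering : Layering G (length Π)
    layering = record
      { layer              = layer
      ; layer<N            = λ v → position<length (anchor-∈Π v)
      ; layer-onto         = onto
      ; crossing-adjacent  = λ u~w u≁w → adjacent (crossing⇒pathEdge u~w u≁w)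
      ; crossing-injective = λ u~w u≁w u′~w′ u′≁w′ same-layer →
          position-injective (on-Π u~w u≁w) (on-Π u′~w′ u′≁w′)
            (trans (sym (layer-on-Π (on-Π u~w u≁w))) (trans same-layer (layer-on-Π (on-Π u′~w′ u′≁w′))))
      }
      where
      onto : ∀ t → t < length Π → Σ (Fin n) λ v → layer v ≡ t
      onto t t< with x , x∈ , position≡t ← position-onto Π-unique t t< = x , trans (layer-on-Π x∈) position≡t
      adjacent : ∀ {u w} → PathEdge u w → layer w ≡ suc (layer u) ⊎ layer u ≡ suc (layer w)
      adjacent (i , inj₁ u→w) = inj₁ (consecutive-layers i u→w)
      adjacent (i , inj₂ w→u) = inj₂ (consecutive-layers i w→u)
      on-Π : ∀ {u w} → Adj u w → layer u ≢ layer w → u ∈ Π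
      on-Π u~w u≁w = pathEdge-∈Π (crossing⇒pathEdge u~w u≁w)

lemma2p1 : (n : ℕ) (G : Graph n) → Forest G → RelDiamGtHalf G →
    (m : ℕ) → 1 ≤ m → m ≤ n →
    Σ (Subset n) λ B → ∣ B ∣ ≡ m × eBW G B ≤ 2
lemma2p1 n G forest (k , s , ps , isPath , apart , cover , _ , n<2S) m _ m≤n =
  LayeredCut.cut G layering n<N+N m m≤n
  where
  -- layers of G along the chosen paths
  open Forests.PathLayering G forest s ps isPath apart cover using (Π; layering; twice-length-Π)
  n<N+N : n < length Π + length Π
  n<N+N = subst (n <_) twice-length-Π n<2S
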